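{- Let $r\ge 2$ and $\ell\ge 1$ be fixed integers. Then ${\rm forb}\big(m,r,\mathcal{T}_{\ell}(r)\setminus \mathcal{T}_{\ell}(2)\big)=\Theta(2^m)$ as $m\to\infty$.
   Context: An $r$-matrix is a matrix with entries in $\{0,1,\ldots,r-1\}$. A matrix is simple if it has no repeated columns. For matrices $F,A$ write $F\prec A$ if some submatrix of $A$ is a row and column permutation of $F$. For a finite family $\mathcal F$ of matrices, ${\rm forb}(m,r,\mathcal F)$ is the maximum number of columns of an $m$-rowed simple $r$-matrix $A$ with $F\not\prec A$ for all $F\in\mathcal F$. For distinct symbols $x,y$, $I_\ell(x,y)$ is the $\ell\times\ell$ matrix with $x$'s on the diagonal and $y$'s elsewhere, and $T_\ell(x,y)$ is the $\ell\times\ell$ matrix with $x$'s strictly below the diagonal and $y$'s on and above the diagonal. $\mathcal T_\ell(r)=\{I_\ell(x,y),\,T_\ell(x,y): x,y\in\{0,\ldots,r-1\},\,x\neq y\}$. -}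

module Defs where

open import Data.Nat using (ℕ; _≤_; _<_)
import Data.Nat
import Relation.Nullary
open import Data.Fin using (Fin; toℕ)
open import Data.Product using (Σ; _×_; ∃)
open import Data.Sum using (_⊎_)
open import Data.Empty using (⊥)
open import Relation.Nullary using (¬_)
open import Relation.Binary.PropositionalEquality using (_≡_; _≢_)
open import Function.Definitions using (Injective)

Mat : ℕ → ℕ → Set
Mat m n = Fin m → Fin n → ℕ

IsRMatrix : ℕ → {m n : ℕ} → Mat m n → Set
IsRMatrix r A = ∀ i j → A i j < r

Simple : {m n : ℕ} → Mat m n → Set
Simple {m} {n} A = ∀ (j j′ : Fin n) → (∀ (i : Fin m) → A i j ≡ A i j′) → j ≡ j′

-- F ≺ A: some submatrix of A is a row and column permutation of F, i.e.
-- there are injective row and column selections realising F inside A.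
_≺_ : {k l m n : ℕ} → Mat k l → Mat m n → Set
_≺_ {k} {l} {m} {n} F A =
  Σ (Fin k → Fin m) λ ρ → Σ (Fin l → Fin n) λ κ →
    Injective _≡_ _≡_ ρ × Injective _≡_ _≡_ κ ×
    (∀ i j → A (ρ i) (κ j) ≡ F i j)

Imat : (ℓ : ℕ) → ℕ → ℕ → Mat ℓ ℓ
Imat ℓ x y i j with toℕ i Data.Nat.≟ toℕ j
... | Relation.Nullary.yes _ = x
... | Relation.Nullary.no _ = y

Tmat : (ℓ : ℕ) → ℕ → ℕ → Mat ℓ ℓ
Tmat ℓ x y i j with toℕ j Data.Nat.<? toℕ i
... | Relation.Nullary.yes _ = x
... | Relation.Nullary.no _ = y

_≐_ : {ℓ : ℕ} → Mat ℓ ℓ → Mat ℓ ℓ → Set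
F ≐ G = ∀ i j → F i j ≡ G i j

In𝒯 : (ℓ r : ℕ) → Mat ℓ ℓ → Set
In𝒯 ℓ r F = Σ ℕ λ x → Σ ℕ λ y → x < r × y < r × x ≢ y ×
  (F ≐ Imat ℓ x y ⊎ F ≐ Tmat ℓ x y)

InDiff : (ℓ r : ℕ) → Mat ℓ ℓ → Set
InDiff ℓ r F = In𝒯 ℓ r F × ¬ In𝒯 ℓ 2 F

AvoidsDiff : (ℓ r : ℕ) → {m n : ℕ} → Mat m n → Set
AvoidsDiff ℓ r A = ∀ (F : Mat ℓ ℓ) → InDiff ℓ r F → ¬ (F ≺ A)

Admissible : (ℓ r : ℕ) → {m n : ℕ} → Mat m n → Set
Admissible ℓ r A = IsRMatrix r A × Simple A × AvoidsDiff ℓ r A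

module Submission where

-- Lower bound: the m × 2^m matrix of all 0/1 columns is admissible, because every
-- configuration inside it is a 0/1 matrix, and a 0/1 member of 𝒯_ℓ(r) lies in 𝒯_ℓ(2).
--
-- Upper bound, n ≤ r^D · 2^m.  Call a staircase of depth d a d × d submatrix, with
-- no entry 1, whose row a is a constant above a ≠ diag a to the right of its
-- diagonal entry diag a.  Splitting the columns by the 1-patterns of the rows gives
-- at most 2^m parts on which every row is identically 1 or never 1.  In such a part
-- with more than r^d columns a greedy argument finds a staircase of depth d: a row
-- that is not constant is never 1; keep its most frequent value x (on more than
-- r^(d-1) columns), recurse there, and prepend the row with a column where it is
-- not x.  An ordered Ramsey argument turns a staircase of depth D = ramseyBound r 2ℓ
-- into a homogeneous one of size 2ℓ, constant below, on and above the diagonal;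
-- inside it sits I_ℓ or T_ℓ on two distinct symbols other than 1, which is a member
-- of 𝒯_ℓ(r) ∖ 𝒯_ℓ(2).

open import Defs
open import Data.Nat using (ℕ; zero; suc; _≤_; _<_; _≮_; _*_; _^_; _+_; _∸_; z≤n; s≤s; z<s; s≤s⁻¹; >-nonZero; _≟_; _≤?_; _<?_)
open import Data.Nat.Properties
open import Data.Bool using (true; false)
open import Data.Product using (Σ; _×_; _,_; proj₁; proj₂; ∃; ∃₂)
open import Data.Sum using (_⊎_; inj₁; inj₂; [_,_]′)
import Data.Sum as Sum
open import Data.Empty using (⊥; ⊥-elim)
open import Data.Fin using (Fin; toℕ; finToFun; funToFin; combine)
import Data.Fin.Properties as FinP
open import Data.List using (List; []; _∷_; length; filter; upTo; allFin)
open import Data.List.Properties using (length-upTo; length-tabulate)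
open import Data.List.Relation.Unary.All as All using (All; []; _∷_)
import Data.List.Relation.Unary.All.Properties as AllP
open import Data.List.Relation.Unary.AllPairs using (AllPairs; []; _∷_)
import Data.List.Relation.Unary.AllPairs.Properties as AllPairsP
open import Data.List.Relation.Unary.Any using (here; there)
open import Data.List.Relation.Unary.Unique.Propositional using (Unique)
import Data.List.Relation.Unary.Unique.Propositional.Properties as UniqueP
open import Data.List.Membership.Propositional using (_∈_; _∉_; find)
open import Data.List.Membership.Propositional.Properties using (∈-filter⁻; ∈-upTo⁻; ∈-allFin)
import Data.List.Relation.Binary.Sublist.Propositional.Properties as Sublist
open import Relation.Nullary using (¬_; ¬?; Dec; yes; no; does)
open import Relation.Unary using (Decidable)
open import Relation.Unary.Properties using (∁?)
open import Relation.Binary.PropositionalEquality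
open import Relation.Binary.Definitions using (tri<; tri≈; tri>)
open import Function using (_∘_; id)

pattern 0F = Fin.zero
pattern 1F = Fin.suc Fin.zero

IsConfig : (ℓ : ℕ) → ℕ → ℕ → Mat ℓ ℓ → Set
IsConfig ℓ x y F = F ≐ Imat ℓ x y ⊎ F ≐ Tmat ℓ x y

imat-diag : ∀ {ℓ} x y (a : Fin ℓ) → Imat ℓ x y a a ≡ x
imat-diag x y a with toℕ a ≟ toℕ a
... | yes _ = refl
... | no a≢a = ⊥-elim (a≢a refl)

imat-off : ∀ {ℓ} x y (a b : Fin ℓ) → toℕ a ≢ toℕ b → Imat ℓ x y a b ≡ y
imat-off x y a b a≢b with toℕ a ≟ toℕ b
... | yes a≡b = ⊥-elim (a≢b a≡b)
... | no _ = refl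

tmat-below : ∀ {ℓ} x y (a b : Fin ℓ) → toℕ b < toℕ a → Tmat ℓ x y a b ≡ x
tmat-below x y a b b<a with toℕ b <? toℕ a
... | yes _ = refl
... | no b≮a = ⊥-elim (b≮a b<a)

tmat-upper : ∀ {ℓ} x y (a b : Fin ℓ) → toℕ b ≮ toℕ a → Tmat ℓ x y a b ≡ y
tmat-upper x y a b b≮a with toℕ b <? toℕ a
... | yes b<a = ⊥-elim (b≮a b<a)
... | no _ = refl

imat-intro : ∀ {ℓ x y} (F : Mat ℓ ℓ) → (∀ a b → toℕ a ≡ toℕ b → F a b ≡ x) →
             (∀ a b → toℕ a ≢ toℕ b → F a b ≡ y) → F ≐ Imat ℓ x y
imat-intro F onDiag offDiag a b with toℕ a ≟ toℕ b
... | yes a≡b = onDiag a b a≡b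
... | no a≢b = offDiag a b a≢b

tmat-intro : ∀ {ℓ x y} (F : Mat ℓ ℓ) → (∀ a b → toℕ b < toℕ a → F a b ≡ x) →
             (∀ a b → toℕ b ≮ toℕ a → F a b ≡ y) → F ≐ Tmat ℓ x y
tmat-intro F lower upper a b with toℕ b <? toℕ a
... | yes b<a = lower a b b<a
... | no b≮a = upper a b b≮a

imat-entry : ∀ {ℓ x y} (P : ℕ → Set) → P x → P y → ∀ (a b : Fin ℓ) → P (Imat ℓ x y a b)
imat-entry P px py a b with toℕ a ≟ toℕ b
... | yes _ = px
... | no _ = py

tmat-entry : ∀ {ℓ x y} (P : ℕ → Set) → P x → P y → ∀ (a b : Fin ℓ) → P (Tmat ℓ x y a b)
tmat-entry P px py a b with toℕ b <? toℕ a
... | yes _ = px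
... | no _ = py

config-entry : ∀ {ℓ x y} {F : Mat ℓ ℓ} → IsConfig ℓ x y F →
               (P : ℕ → Set) → P x → P y → ∀ a b → P (F a b)
config-entry (inj₁ F≐I) P px py a b = subst P (sym (F≐I a b)) (imat-entry P px py a b)
config-entry (inj₂ F≐T) P px py a b = subst P (sym (F≐T a b)) (tmat-entry P px py a b)

config-symbols : ∀ {k x y} {F : Mat (2 + k) (2 + k)} → IsConfig (2 + k) x y F →
                 (P : ℕ → Set) → (∀ a b → P (F a b)) → P x × P y
config-symbols (inj₁ F≐I) P all =
  subst P (F≐I 0F 0F) (all 0F 0F) , subst P (F≐I 0F 1F) (all 0F 1F)
config-symbols (inj₂ F≐T) P all =
  subst P (F≐T 1F 0F) (all 1F 0F) , subst P (F≐T 0F 0F) (all 0F 0F)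

in𝒯₂-binary : ∀ {ℓ} {F : Mat ℓ ℓ} → In𝒯 ℓ 2 F → ∀ a b → F a b < 2
in𝒯₂-binary (x , y , x<2 , y<2 , _ , config) = config-entry config (_< 2) x<2 y<2

two-or-more : ∀ {x y} → x ≢ y → x ≢ 1 → y ≢ 1 → 2 ≤ x ⊎ 2 ≤ y
two-or-more {0} {0} x≢y _ _ = ⊥-elim (x≢y refl)
two-or-more {0} {1} _ _ y≢1 = ⊥-elim (y≢1 refl)
two-or-more {0} {suc (suc _)} _ _ _ = inj₂ (s≤s (s≤s z≤n))
two-or-more {1} _ x≢1 _ = ⊥-elim (x≢1 refl)
two-or-more {suc (suc _)} _ _ _ = inj₁ (s≤s (s≤s z≤n))

config-notIn𝒯₂ : ∀ {k x y} {F : Mat (2 + k) (2 + k)} → IsConfig (2 + k) x y F →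
                 x ≢ y → x ≢ 1 → y ≢ 1 → ¬ In𝒯 (2 + k) 2 F
config-notIn𝒯₂ config x≢y x≢1 y≢1 F∈𝒯₂ with config-symbols config (_< 2) (in𝒯₂-binary F∈𝒯₂)
... | x<2 , y<2 = [ <⇒≱ x<2 , <⇒≱ y<2 ]′ (two-or-more x≢y x≢1 y≢1)

-- In a configuration on distinct symbols, different rows (columns) differ somewhere:
-- compare them in the column (row) of the diagonal entry of the one that is
-- further up (left).
config-rows-distinct : ∀ {ℓ x y} {F : Mat ℓ ℓ} → IsConfig ℓ x y F → x ≢ y →
                       ∀ a a′ → (∀ b → F a b ≡ F a′ b) → a ≡ a′
config-rows-distinct {x = x} {y} {F} (inj₁ F≐I) x≢y a a′ same with a FinP.≟ a′
... | yes a≡a′ = a≡a′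
... | no a≢a′ = ⊥-elim (x≢y (begin
  x              ≡⟨ sym (imat-diag x y a) ⟩
  Imat _ x y a a ≡⟨ sym (F≐I a a) ⟩
  F a a          ≡⟨ same a ⟩
  F a′ a         ≡⟨ F≐I a′ a ⟩
  Imat _ x y a′ a ≡⟨ imat-off x y a′ a (a≢a′ ∘ sym ∘ FinP.toℕ-injective) ⟩
  y              ∎))
  where open ≡-Reasoning
config-rows-distinct {x = x} {y} {F} (inj₂ F≐T) x≢y a a′ same with <-cmp (toℕ a) (toℕ a′)
... | tri≈ _ a≡a′ _ = FinP.toℕ-injective a≡a′
... | tri< a<a′ _ _ = ⊥-elim (x≢y (begin
  x               ≡⟨ sym (tmat-below x y a′ a a<a′) ⟩
  Tmat _ x y a′ a ≡⟨ sym (F≐T a′ a) ⟩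
  F a′ a          ≡⟨ sym (same a) ⟩
  F a a           ≡⟨ F≐T a a ⟩
  Tmat _ x y a a  ≡⟨ tmat-upper x y a a (n≮n _) ⟩
  y               ∎))
  where open ≡-Reasoning
... | tri> _ _ a′<a = ⊥-elim (x≢y (begin
  x               ≡⟨ sym (tmat-below x y a a′ a′<a) ⟩
  Tmat _ x y a a′ ≡⟨ sym (F≐T a a′) ⟩
  F a a′          ≡⟨ same a′ ⟩
  F a′ a′         ≡⟨ F≐T a′ a′ ⟩
  Tmat _ x y a′ a′ ≡⟨ tmat-upper x y a′ a′ (n≮n _) ⟩
  y               ∎))
  where open ≡-Reasoning

config-cols-distinct : ∀ {ℓ x y} {F : Mat ℓ ℓ} → IsConfig ℓ x y F → x ≢ y →
                       ∀ b b′ → (∀ a → F a b ≡ F a b′) → b ≡ b′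
config-cols-distinct {x = x} {y} {F} (inj₁ F≐I) x≢y b b′ same with b FinP.≟ b′
... | yes b≡b′ = b≡b′
... | no b≢b′ = ⊥-elim (x≢y (begin
  x               ≡⟨ sym (imat-diag x y b) ⟩
  Imat _ x y b b  ≡⟨ sym (F≐I b b) ⟩
  F b b           ≡⟨ same b ⟩
  F b b′          ≡⟨ F≐I b b′ ⟩
  Imat _ x y b b′ ≡⟨ imat-off x y b b′ (b≢b′ ∘ FinP.toℕ-injective) ⟩
  y               ∎))
  where open ≡-Reasoning
config-cols-distinct {x = x} {y} {F} (inj₂ F≐T) x≢y b b′ same with <-cmp (toℕ b) (toℕ b′)
... | tri≈ _ b≡b′ _ = FinP.toℕ-injective b≡b′
... | tri< b<b′ _ _ = ⊥-elim (x≢y (begin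
  x                ≡⟨ sym (tmat-below x y b′ b b<b′) ⟩
  Tmat _ x y b′ b  ≡⟨ sym (F≐T b′ b) ⟩
  F b′ b           ≡⟨ same b′ ⟩
  F b′ b′          ≡⟨ F≐T b′ b′ ⟩
  Tmat _ x y b′ b′ ≡⟨ tmat-upper x y b′ b′ (n≮n _) ⟩
  y                ∎))
  where open ≡-Reasoning
... | tri> _ _ b′<b = ⊥-elim (x≢y (begin
  x               ≡⟨ sym (tmat-below x y b b′ b′<b) ⟩
  Tmat _ x y b b′ ≡⟨ sym (F≐T b b′) ⟩
  F b b′          ≡⟨ sym (same b) ⟩
  F b b           ≡⟨ F≐T b b ⟩
  Tmat _ x y b b  ≡⟨ tmat-upper x y b b (n≮n _) ⟩
  y               ∎))
  where open ≡-Reasoning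

submatrix : ∀ {ℓ m n} → Mat m n → (Fin ℓ → Fin m) → (Fin ℓ → Fin n) → Mat ℓ ℓ
submatrix A ρ κ a b = A (ρ a) (κ b)

-- A submatrix with the shape of a configuration on distinct symbols has distinct
-- rows and columns, so the selections ρ, κ are injective and the configuration is in A.
config-≺ : ∀ {ℓ m n x y} (A : Mat m n) (ρ : Fin ℓ → Fin m) (κ : Fin ℓ → Fin n) →
           IsConfig ℓ x y (submatrix A ρ κ) → x ≢ y → submatrix A ρ κ ≺ A
config-≺ A ρ κ config x≢y =
  ρ , κ ,
  (λ {a} {a′} ρa≡ρa′ → config-rows-distinct config x≢y a a′ (λ b → cong (λ i → A i (κ b)) ρa≡ρa′)) ,
  (λ {b} {b′} κb≡κb′ → config-cols-distinct config x≢y b b′ (λ a → cong (A (ρ a)) κb≡κb′)) ,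
  (λ a b → refl)

config-violates : ∀ {k m n r x y} (A : Mat m n) → IsRMatrix r A → AvoidsDiff (2 + k) r A →
                  (ρ : Fin (2 + k) → Fin m) (κ : Fin (2 + k) → Fin n) →
                  IsConfig (2 + k) x y (submatrix A ρ κ) → x ≢ y → x ≢ 1 → y ≢ 1 → ⊥
config-violates {r = r} A A<r avoids ρ κ config x≢y x≢1 y≢1
  with config-symbols config (_< r) (λ a b → A<r (ρ a) (κ b))
... | x<r , y<r =
  avoids (submatrix A ρ κ)
         ((_ , _ , x<r , y<r , x≢y , config) , config-notIn𝒯₂ config x≢y x≢1 y≢1)
         (config-≺ A ρ κ config x≢y)

-- For ℓ = 1 the same holds for a single entry z ≥ 2, which is I_1(z,0).
entry-violates : ∀ {m n r} (A : Mat m n) → IsRMatrix r A → AvoidsDiff 1 r A →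
                 ∀ i j → 2 ≤ A i j → ⊥
entry-violates A A<r avoids i j 2≤z =
  avoids F ((A i j , 0 , A<r i j , ≤-trans (s≤s z≤n) (A<r i j) , z≢0 , inj₁ λ { 0F 0F → refl }) ,
            λ F∈𝒯₂ → <⇒≱ (in𝒯₂-binary F∈𝒯₂ 0F 0F) 2≤z)
         ((λ _ → i) , (λ _ → j) , (λ { {0F} {0F} _ → refl }) , (λ { {0F} {0F} _ → refl }) , λ a b → refl)
  where
    F : Mat 1 1
    F _ _ = A i j
    z≢0 : A i j ≢ 0
    z≢0 z≡0 = <⇒≱ (subst (1 <_) z≡0 2≤z) z≤n

-- A 0/1 member of 𝒯_ℓ(r) is already in 𝒯_ℓ(2): for ℓ ≥ 2 its symbols occur as
-- entries, and a single entry z ∈ {0,1} is I_1(z, 1 ∸ z).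
binary-in𝒯₂ : ∀ {ℓ r} {F : Mat ℓ ℓ} → 1 ≤ ℓ → (∀ a b → F a b < 2) → In𝒯 ℓ r F → In𝒯 ℓ 2 F
binary-in𝒯₂ {1} {F = F} _ F<2 _ =
  F 0F 0F , 1 ∸ F 0F 0F , F<2 0F 0F , s≤s (m∸n≤m 1 (F 0F 0F)) , bit≢flip (F<2 0F 0F) ,
  inj₁ λ { 0F 0F → refl }
  where
    bit≢flip : ∀ {z} → z < 2 → z ≢ 1 ∸ z
    bit≢flip {0} _ ()
    bit≢flip {1} _ ()
binary-in𝒯₂ {suc (suc k)} _ F<2 (x , y , _ , _ , x≢y , config)
  with config-symbols config (_< 2) F<2
... | x<2 , y<2 = x , y , x<2 , y<2 , x≢y , config

binaryCube : (m : ℕ) → Mat m (2 ^ m)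
binaryCube m i j = toℕ (finToFun {m = 2} {n = m} j i)

funToFin-cong : ∀ {k t} {f g : Fin k → Fin t} → (∀ i → f i ≡ g i) → funToFin f ≡ funToFin g
funToFin-cong {zero} f≗g = refl
funToFin-cong {suc k} f≗g = cong₂ combine (f≗g Fin.zero) (funToFin-cong (f≗g ∘ Fin.suc))

binaryCube-simple : ∀ m → Simple (binaryCube m)
binaryCube-simple m j j′ same = begin
  j                    ≡⟨ sym (FinP.funToFin-finToFin {m} {2} j) ⟩
  funToFin (column j)  ≡⟨ funToFin-cong (λ i → FinP.toℕ-injective (same i)) ⟩
  funToFin (column j′) ≡⟨ FinP.funToFin-finToFin {m} {2} j′ ⟩
  j′                   ∎
  where
    open ≡-Reasoning
    column : Fin (2 ^ m) → Fin m → Fin 2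
    column = finToFun

-- Every configuration inside binaryCube m is a 0/1 matrix, hence lies in 𝒯_ℓ(2).
binaryCube-admissible : ∀ {ℓ r} m → 1 ≤ ℓ → 2 ≤ r → Admissible ℓ r (binaryCube m)
binaryCube-admissible m 1≤ℓ 2≤r =
  (λ i j → <-≤-trans (FinP.toℕ<n _) 2≤r) ,
  binaryCube-simple m ,
  λ F (F∈𝒯 , F∉𝒯₂) (ρ , κ , _ , _ , F≡) →
    F∉𝒯₂ (binary-in𝒯₂ 1≤ℓ (λ a b → subst (_< 2) (F≡ a b) (FinP.toℕ<n _)) F∈𝒯)

length-split : ∀ {X : Set} {P : X → Set} (P? : Decidable P) xs →
               length xs ≡ length (filter P? xs) + length (filter (∁? P?) xs)
length-split P? [] = refl
length-split P? (x ∷ xs) with does (P? x)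
... | true = cong suc (length-split P? xs)
... | false = trans (cong suc (length-split P? xs)) (sym (+-suc _ _))

module Pigeonhole {X : Set} (colour : X → ℕ) where

  classOf : ℕ → List X → List X
  classOf x = filter (λ a → colour a ≟ x)

  classOf-⊆ : ∀ x S {a} → a ∈ classOf x S → a ∈ S
  classOf-⊆ x S = proj₁ ∘ ∈-filter⁻ (λ a → colour a ≟ x)

  classOf-colour : ∀ x S → All (λ a → colour a ≡ x) (classOf x S)
  classOf-colour x = AllP.all-filter (λ a → colour a ≟ x)

  -- Peel off the class of the top colour k: either it
  -- is large, or the remaining elements, coloured below k, are more than kB.
  pigeonhole : ∀ k B S → All (λ a → colour a < k) S → k * B < length S →
               ∃ λ x → x < k × B < length (classOf x S)
  pigeonhole zero B (a ∷ S) (() ∷ _) _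
  pigeonhole (suc k) B S colours big with B <? length (classOf k S)
  ... | yes large = k , n<1+n k , large
  ... | no notLarge with pigeonhole k B rest rest-colours rest-big
    where
      rest : List X
      rest = filter (λ a → ¬? (colour a ≟ k)) S
      rest-colours : All (λ a → colour a < k) rest
      rest-colours = All.tabulate λ a∈rest →
        let a∈S , colour≢k = ∈-filter⁻ (λ a → ¬? (colour a ≟ k)) a∈rest
        in ≤∧≢⇒< (s≤s⁻¹ (All.lookup colours a∈S)) colour≢k
      rest-big : k * B < length rest
      rest-big = +-cancelˡ-< B (k * B) (length rest) (begin-strict
        B + k * B                           <⟨ big ⟩
        length S                            ≡⟨ length-split (λ a → colour a ≟ k) S ⟩
        length (classOf k S) + length rest  ≤⟨ +-monoˡ-≤ (length rest) (≮⇒≥ notLarge) ⟩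
        B + length rest                     ∎)
        where open ≤-Reasoning
  ... | x , x<k , large = x , m<n⇒m<1+n x<k , <-≤-trans large classOf-rest≤classOf
    where
      classOf-rest≤classOf : length (classOf x (filter (λ a → ¬? (colour a ≟ k)) S)) ≤ length (classOf x S)
      classOf-rest≤classOf = Sublist.length-mono-≤
        (Sublist.filter⁺ (λ a → colour a ≟ x) (λ a → colour a ≟ x) (λ { refl c≡x → c≡x })
                         (Sublist.filter-⊆ (λ a → ¬? (colour a ≟ k)) S))

  pigeonhole≤ : ∀ k B S → 0 < k → All (λ a → colour a < k) S → k * B ≤ length S →
                ∃ λ x → x < k × B ≤ length (classOf x S)
  pigeonhole≤ (suc k) zero S _ _ _ = 0 , z<s , z≤n
  pigeonhole≤ (suc k) (suc B) S _ colours big =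
    pigeonhole (suc k) B S colours (<-≤-trans (*-monoʳ-< (suc k) (n<1+n B)) big)

-- The k-th element of a list, or a default beyond its end; used to read off a
-- list of indices as an increasing function.
nth : {X : Set} → X → List X → ℕ → X
nth d [] _ = d
nth d (x ∷ xs) zero = x
nth d (x ∷ xs) (suc k) = nth d xs k

nth-∈ : ∀ {X : Set} (d : X) xs k → k < length xs → nth d xs k ∈ xs
nth-∈ d (x ∷ xs) zero _ = here refl
nth-∈ d (x ∷ xs) (suc k) (s≤s k<len) = there (nth-∈ d xs k k<len)

nth-AllPairs : ∀ {X : Set} {R : X → X → Set} (d : X) {xs} → AllPairs R xs →
               ∀ a b → a < b → b < length xs → R (nth d xs a) (nth d xs b)
nth-AllPairs d (Rx ∷ _) zero (suc b) _ (s≤s b<len) = All.lookup Rx (nth-∈ d _ b b<len)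
nth-AllPairs d (_ ∷ pairs) (suc a) (suc b) (s≤s a<b) (s≤s b<len) = nth-AllPairs d pairs a b a<b b<len

-- Length needed by the greedy construction of an end-homogeneous sequence of length t
-- with r colours: besides the first element, r times the length needed for t - 1.
endBound : ℕ → ℕ → ℕ
endBound r zero = 0
endBound r (suc t) = suc (r * endBound r t)

ramseyBound : ℕ → ℕ → ℕ
ramseyBound r L = endBound r (r * (r * (r * L)))

module Ramsey (r : ℕ) (0<r : 0 < r) (U : ℕ → ℕ → ℕ) (U<r : ∀ a b → U a b < r) where
  open Pigeonhole

  -- An index together with the colour it receives with every later index.
  EndHomogeneous : ℕ × ℕ → ℕ × ℕ → Set
  EndHomogeneous p q = proj₁ p < proj₁ q × U (proj₁ p) (proj₁ q) ≡ proj₂ p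

  -- Greedy construction: keep the first index x and continue inside the largest
  -- class of the colouring U x of the later indices.
  endHomogeneous : ∀ t xs → AllPairs _<_ xs → endBound r t ≤ length xs →
    Σ (List (ℕ × ℕ)) λ ys → AllPairs EndHomogeneous ys × All (λ p → proj₂ p < r) ys ×
                            All (λ p → proj₁ p ∈ xs) ys × t ≤ length ys
  endHomogeneous zero xs _ _ = [] , [] , [] , [] , z≤n
  endHomogeneous (suc t) (x ∷ xs) (x< ∷ sorted) (s≤s big)
    with c , c<r , large ← pigeonhole≤ (U x) r (endBound r t) xs 0<r (All.tabulate (λ _ → U<r x _)) big
    with ys , endHom , colours , mem , len ←
         endHomogeneous t (classOf (U x) c xs) (AllPairsP.filter⁺ _ sorted) large
    = (x , c) ∷ ys ,
      All.tabulate (λ {p} p∈ys → let x∈ = All.lookup mem p∈ys in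
                      All.lookup x< (classOf-⊆ (U x) c xs x∈) , All.lookup (classOf-colour (U x) c xs) x∈)
        ∷ endHom ,
      c<r ∷ colours ,
      here refl ∷ All.map (there ∘ classOf-⊆ (U x) c xs) mem ,
      s≤s len

  record Homogeneous (L D : ℕ) (V W : ℕ → ℕ) : Set where
    field
      pos : ℕ → ℕ
      u v w : ℕ
      pos-increasing : ∀ a b → a < b → b < L → pos a < pos b
      pos-bounded : ∀ a → a < L → pos a < D
      U-constant : ∀ a b → a < b → b < L → U (pos a) (pos b) ≡ u
      V-constant : ∀ a → a < L → V (pos a) ≡ v
      W-constant : ∀ a → a < L → W (pos a) ≡ w

  -- Ramsey: take an end-homogeneous sequence of length r³L among the indices below
  -- ramseyBound r L, then by pigeonhole a subsequence of length L on which the end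
  -- colour, V and W are constant.
  ramsey : ∀ L V W → (∀ j → V j < r) → (∀ j → W j < r) → Homogeneous L (ramseyBound r L) V W
  ramsey L V W V<r W<r
    with ys , endHom , colours , mem , len ←
         endHomogeneous (r * (r * (r * L))) (upTo (ramseyBound r L))
                        (AllPairsP.applyUpTo⁺₁ id (ramseyBound r L) (λ i<j _ → i<j))
                        (≤-reflexive (sym (length-upTo (ramseyBound r L))))
    with c₁ , _ , len₁ ← pigeonhole≤ proj₂ r (r * (r * L)) ys 0<r colours len
    with c₂ , _ , len₂ ← pigeonhole≤ (V ∘ proj₁) r (r * L) (classOf proj₂ c₁ ys) 0<r
                                     (All.tabulate (λ _ → V<r _)) len₁
    with c₃ , _ , len₃ ← pigeonhole≤ (W ∘ proj₁) r L (classOf (V ∘ proj₁) c₂ (classOf proj₂ c₁ ys)) 0<r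
                                     (All.tabulate (λ _ → W<r _)) len₂
    = record
      { pos = proj₁ ∘ entry
      ; u = c₁ ; v = c₂ ; w = c₃
      ; pos-increasing = λ a b a<b b<L → proj₁ (pairs a b a<b b<L)
      ; pos-bounded = λ a a<L → ∈-upTo⁻ (holds (AllP.filter⁺ _ (AllP.filter⁺ _ (AllP.filter⁺ _ mem))) a a<L)
      ; U-constant = λ a b a<b b<L →
          trans (proj₂ (pairs a b a<b b<L))
                (holds (AllP.filter⁺ _ (AllP.filter⁺ _ (classOf-colour proj₂ c₁ ys))) a (<-trans a<b b<L))
      ; V-constant = holds (AllP.filter⁺ _ (classOf-colour (V ∘ proj₁) c₂ ys₁))
      ; W-constant = holds (classOf-colour (W ∘ proj₁) c₃ ys₂)
      }
    where
      ys₁ ys₂ zs : List (ℕ × ℕ)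
      ys₁ = classOf proj₂ c₁ ys
      ys₂ = classOf (V ∘ proj₁) c₂ ys₁
      zs = classOf (W ∘ proj₁) c₃ ys₂
      entry : ℕ → ℕ × ℕ
      entry = nth (0 , 0) zs
      holds : ∀ {P : ℕ × ℕ → Set} → All P zs → ∀ a → a < L → P (entry a)
      holds all a a<L = All.lookup all (nth-∈ (0 , 0) zs a (<-≤-trans a<L len₃))
      pairs : ∀ a b → a < b → b < L → EndHomogeneous (entry a) (entry b)
      pairs a b a<b b<L = nth-AllPairs (0 , 0)
        (AllPairsP.filter⁺ _ (AllPairsP.filter⁺ _ (AllPairsP.filter⁺ _ endHom))) a b a<b (<-≤-trans b<L len₃)

length≤1 : ∀ {X : Set} (S : List X) → Unique S → (∀ {a b} → a ∈ S → b ∈ S → a ≡ b) → length S ≤ 1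
length≤1 [] _ _ = z≤n
length≤1 (a ∷ []) _ _ = s≤s z≤n
length≤1 (a ∷ b ∷ S) ((a≢b All.∷ _) ∷ _) allEqual = ⊥-elim (a≢b (allEqual (here refl) (there (here refl))))

one-differs : ∀ {p q : ℕ} x → p ≢ q → p ≢ x ⊎ q ≢ x
one-differs {p} x p≢q with p ≟ x
... | yes refl = inj₂ (p≢q ∘ sym)
... | no p≢x = inj₁ p≢x

nonempty-member : ∀ {X : Set} (xs : List X) → 0 < length xs → ∃ λ x → x ∈ xs
nonempty-member (x ∷ xs) _ = x , here refl

prepend : {B : Set} → B → (ℕ → B) → ℕ → B
prepend b f zero = b
prepend b f (suc j) = f j

module Staircases {m n : ℕ} (r : ℕ) (A : Mat m n) where
  open Pigeonhole

  _⊆_ : List (Fin n) → List (Fin n) → Set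
  T ⊆ S = ∀ {a} → a ∈ T → a ∈ S

  record Staircase (S : List (Fin n)) (d : ℕ) : Set where
    constructor staircase
    field
      row : ℕ → Fin m
      col : ℕ → Fin n
      above diag : ℕ → ℕ
      above<r : ∀ j → above j < r
      diag<r : ∀ j → diag j < r
      on-above : ∀ a b → a < b → b < d → A (row a) (col b) ≡ above a
      on-diag : ∀ j → j < d → A (row j) (col j) ≡ diag j
      above≢diag : ∀ j → j < d → above j ≢ diag j
      no-ones : ∀ a b → a < d → b < d → A (row a) (col b) ≢ 1
      col∈ : ∀ j → j < d → col j ∈ S

  weaken : ∀ {T S d} → Staircase T d → T ⊆ S → Staircase S d
  weaken (staircase row col above diag above<r diag<r on-above on-diag above≢diag no-ones col∈) T⊆S =
    staircase row col above diag above<r diag<r on-above on-diag above≢diag no-ones (λ j → T⊆S ∘ col∈ j)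

  OneUniform : List (Fin n) → Fin m → Set
  OneUniform S i = (∀ a → a ∈ S → A i a ≡ 1) ⊎ (∀ a → a ∈ S → A i a ≢ 1)

  restrict-uniform : ∀ {T S i} → T ⊆ S → OneUniform S i → OneUniform T i
  restrict-uniform T⊆S = Sum.map (λ ones a → ones a ∘ T⊆S) (λ noOnes a → noOnes a ∘ T⊆S)

  ConstantOn : List (Fin n) → Fin m → Set
  ConstantOn S i = ∀ a b → a ∈ S → b ∈ S → A i a ≡ A i b

  ConstantOutside : List (Fin m) → List (Fin n) → Set
  ConstantOutside R S = ∀ i → i ∉ R → ConstantOn S i

  constantOrSplit : ∀ i S → ConstantOn S i ⊎ ∃₂ λ a b → a ∈ S × b ∈ S × A i a ≢ A i b
  constantOrSplit i [] = inj₁ (λ _ _ ())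
  constantOrSplit i (s ∷ S) with All.all? (λ a → A i a ≟ A i s) (s ∷ S)
  ... | yes same = inj₁ (λ a b a∈ b∈ → trans (All.lookup same a∈) (sym (All.lookup same b∈)))
  ... | no notSame with a , a∈ , differs ← find (AllP.¬All⇒Any¬ (λ a → A i a ≟ A i s) (s ∷ S) notSame)
    = inj₂ (a , s , a∈ , here refl , differs)

  split⇒noOnes : ∀ {S i a b} → OneUniform S i → a ∈ S → b ∈ S → A i a ≢ A i b →
                 ∀ c → c ∈ S → A i c ≢ 1
  split⇒noOnes (inj₁ ones) a∈ b∈ differs = ⊥-elim (differs (trans (ones _ a∈) (sym (ones _ b∈))))
  split⇒noOnes (inj₂ noOnes) _ _ _ = noOnes

  restrict-constant : ∀ {T S i} → T ⊆ S → ConstantOn S i → ConstantOn T i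
  restrict-constant T⊆S constant a b a∈ b∈ = constant a b (T⊆S a∈) (T⊆S b∈)

  avoidValue : ∀ {S i a b} → a ∈ S → b ∈ S → A i a ≢ A i b → ∀ x → ∃ λ c → c ∈ S × A i c ≢ x
  avoidValue {a = a} {b} a∈ b∈ differs x with one-differs x differs
  ... | inj₁ a≢x = a , a∈ , a≢x
  ... | inj₂ b≢x = b , b∈ , b≢x

  outside-step : {P : List (Fin n) → Fin m → Set} → (∀ {T S i} → T ⊆ S → P S i → P T i) →
                 ∀ {i R S T} → (∀ i′ → i′ ∉ i ∷ R → P S i′) → T ⊆ S → P T i →
                 ∀ i′ → i′ ∉ R → P T i′
  outside-step restrict {i} outside T⊆S onRow i′ i′∉R with i′ FinP.≟ i
  ... | yes refl = onRow
  ... | no i′≢i = restrict T⊆S (outside i′ λ { (here i′≡i) → i′≢i i′≡i ; (there i′∈R) → i′∉R i′∈R })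

  onClass : ∀ i x S {a} → a ∈ classOf (A i) x S → A i a ≡ x
  onClass i x S = All.lookup (classOf-colour (A i) x S)

  -- Staircases are found greedily in a simple r-matrix.  The default row and column
  -- only fill the unconstrained positions of the empty staircase.
  module Construction (A<r : IsRMatrix r A) (simple : Simple A) (0<r : 0 < r)
                      (row₀ : Fin m) (col₀ : Fin n) where

    emptyStaircase : ∀ S → Staircase S 0
    emptyStaircase S = record
      { row = λ _ → row₀ ; col = λ _ → col₀ ; above = λ _ → 0 ; diag = λ _ → 0
      ; above<r = λ _ → 0<r ; diag<r = λ _ → 0<r
      ; on-above = λ _ _ _ () ; on-diag = λ _ () ; above≢diag = λ _ ()
      ; no-ones = λ _ _ () ; col∈ = λ _ () }

    -- Putting row i and column c in front of a staircase on T gives a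
    -- staircase on S; the new column avoids 1 in the old rows because these are
    -- one-uniform on S and avoid 1 in the old columns.
    extendStaircase : ∀ {S T d} (i : Fin m) (x : ℕ) → (∀ i′ → OneUniform S i′) →
      T ⊆ S → (∀ a → a ∈ T → A i a ≡ x) → (∀ a → a ∈ S → A i a ≢ 1) →
      x < r → x ≢ 1 → (∃ λ c → c ∈ S × A i c ≢ x) → Staircase T d → Staircase S (suc d)
    extendStaircase {S} {T} {d} i x unif T⊆S rowOnT noOnes x<r x≢1 (c , c∈S , c≢x) st = record
      { row = prepend i row ; col = prepend c col
      ; above = prepend x above ; diag = prepend (A i c) diag
      ; above<r = λ { zero → x<r ; (suc j) → above<r j }
      ; diag<r = λ { zero → A<r i c ; (suc j) → diag<r j }
      ; on-above = λ { zero (suc b) _ (s≤s b<d) → rowOnT (col b) (col∈ b b<d)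
                     ; (suc a) (suc b) (s≤s a<b) (s≤s b<d) → on-above a b a<b b<d }
      ; on-diag = λ { zero _ → refl ; (suc j) (s≤s j<d) → on-diag j j<d }
      ; above≢diag = λ { zero _ → c≢x ∘ sym ; (suc j) (s≤s j<d) → above≢diag j j<d }
      ; no-ones = λ { zero b _ b<1+d → noOnes (prepend c col b) (col∈′ b b<1+d)
                    ; (suc a) zero (s≤s a<d) _ → oldRowNewCol a a<d
                    ; (suc a) (suc b) (s≤s a<d) (s≤s b<d) → no-ones a b a<d b<d }
      ; col∈ = col∈′ }
      where
        open Staircase st
        col∈′ : ∀ j → j < suc d → prepend c col j ∈ S
        col∈′ zero _ = c∈S
        col∈′ (suc j) (s≤s j<d) = T⊆S (col∈ j j<d)
        oldRowNewCol : ∀ a → a < d → A (row a) c ≢ 1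
        oldRowNewCol a a<d with unif (row a)
        ... | inj₁ ones = ⊥-elim (no-ones a 0 a<d 0<d (ones (col 0) (T⊆S (col∈ 0 0<d))))
          where
            0<d : 0 < d
            0<d = ≤-trans z<s a<d
        ... | inj₂ noOnes′ = noOnes′ c c∈S

    -- Without candidate rows, S has at most one column since A is simple.  A row
    -- i ∈ R constant on S is discarded.  Otherwise row i is never 1 on S and, if
    -- |S| > r · r^d, one of its values x is taken on more than r^d columns; recurse
    -- on these and extend the staircase found there by row i.
    staircaseOrFew : ∀ d R S → Unique S → ConstantOutside R S → (∀ i → OneUniform S i) →
                     length S ≤ r ^ d ⊎ Staircase S d
    staircaseOrFew zero R S _ _ _ = inj₂ (emptyStaircase S)
    staircaseOrFew (suc d) [] S unique constant _ =
      inj₁ (≤-trans (length≤1 S unique (λ a∈ b∈ → simple _ _ (λ i → constant i (λ ()) _ _ a∈ b∈)))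
                    (m^n>0 r {{>-nonZero 0<r}} (suc d)))
    staircaseOrFew (suc d) (i ∷ R) S unique constant unif with constantOrSplit i S
    ... | inj₁ i-constant =
      staircaseOrFew (suc d) R S unique (outside-step restrict-constant constant id i-constant) unif
    ... | inj₂ (a , b , a∈ , b∈ , a≢b) with length S ≤? r * r ^ d
    ...   | yes few = inj₁ few
    ...   | no many with pigeonhole (A i) r (r ^ d) S (All.tabulate λ _ → A<r i _) (≰⇒> many)
    ...     | x , x<r , large
      with staircaseOrFew d R (classOf (A i) x S) (UniqueP.filter⁺ _ unique)
             (outside-step restrict-constant constant (classOf-⊆ (A i) x S) classConstant)
             (λ i′ → restrict-uniform (classOf-⊆ (A i) x S) (unif i′))
      where
        classConstant : ConstantOn (classOf (A i) x S) i
        classConstant a b a∈ b∈ = trans (onClass i x S a∈) (sym (onClass i x S b∈))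
    ...       | inj₁ small = ⊥-elim (<⇒≱ large small)
    ...       | inj₂ st =
      inj₂ (extendStaircase i x unif (classOf-⊆ (A i) x S) (λ _ → onClass i x S) noOnes x<r x≢1
                            (avoidValue a∈ b∈ a≢b x) st)
      where
        noOnes : ∀ c → c ∈ S → A i c ≢ 1
        noOnes = split⇒noOnes (unif i) a∈ b∈ a≢b
        x≢1 : x ≢ 1
        x≢1 x≡1 with t , t∈ ← nonempty-member (classOf (A i) x S) (≤-trans z<s large)
          = noOnes t (classOf-⊆ (A i) x S t∈) (trans (onClass i x S t∈) x≡1)

    -- Splitting step.  Split S by the 1-pattern of the rows in R; each of the at most
    -- 2^|R| parts makes all rows one-uniform and is handled by staircaseOrFew.
    splitOnOnes : ∀ d R S → Unique S → (∀ i → i ∉ R → OneUniform S i) →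
                  length S ≤ r ^ d * 2 ^ length R ⊎ Staircase S d
    splitOnOnes d [] S unique unif =
      Sum.map₁ (λ few → ≤-trans few (≤-reflexive (sym (*-identityʳ _))))
               (staircaseOrFew d (allFin m) S unique (λ i i∉ → ⊥-elim (i∉ (∈-allFin i))) (λ i → unif i (λ ())))
    splitOnOnes d (i ∷ R) S unique unif
      with splitOnOnes d R (filter isOne? S) (UniqueP.filter⁺ isOne? unique)
             (outside-step restrict-uniform unif (proj₁ ∘ ∈-filter⁻ isOne? {xs = S})
                           (inj₁ λ _ → proj₂ ∘ ∈-filter⁻ isOne? {xs = S}))
         | splitOnOnes d R (filter notOne? S) (UniqueP.filter⁺ notOne? unique)
             (outside-step restrict-uniform unif (proj₁ ∘ ∈-filter⁻ notOne? {xs = S})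
                           (inj₂ λ _ → proj₂ ∘ ∈-filter⁻ notOne? {xs = S}))
      where
        isOne? : ∀ a → Dec (A i a ≡ 1)
        isOne? a = A i a ≟ 1
        notOne? : ∀ a → Dec (A i a ≢ 1)
        notOne? a = ¬? (A i a ≟ 1)
    ... | inj₂ st | _ = inj₂ (weaken st (proj₁ ∘ ∈-filter⁻ (λ a → A i a ≟ 1)))
    ... | inj₁ _ | inj₂ st = inj₂ (weaken st (proj₁ ∘ ∈-filter⁻ (λ a → ¬? (A i a ≟ 1))))
    ... | inj₁ few₁ | inj₁ few₂ = inj₁ (begin
      length S                                     ≡⟨ length-split (λ a → A i a ≟ 1) S ⟩
      length (filter (λ a → A i a ≟ 1) S) + length (filter (λ a → ¬? (A i a ≟ 1)) S)
                                                   ≤⟨ +-mono-≤ few₁ few₂ ⟩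
      r ^ d * 2 ^ length R + r ^ d * 2 ^ length R  ≡⟨ doubling (r ^ d) (2 ^ length R) ⟩
      r ^ d * 2 ^ length (i ∷ R)                   ∎)
      where
        open ≤-Reasoning
        doubling : ∀ X y → X * y + X * y ≡ X * (2 * y)
        doubling X y = trans (cong (λ z → X * y + X * z) (sym (+-identityʳ y)))
                             (sym (*-distribˡ-+ X y (y + 0)))

    fewOrStaircase : ∀ d → n ≤ r ^ d * 2 ^ m ⊎ Staircase (allFin n) d
    fewOrStaircase d with splitOnOnes d (allFin m) (allFin n) (UniqueP.allFin⁺ n)
                                      (λ i i∉ → ⊥-elim (i∉ (∈-allFin i)))
    ... | inj₂ st = inj₂ st
    ... | inj₁ few = inj₁ (subst₂ (λ k l → k ≤ r ^ d * 2 ^ l) (length-allFin n) (length-allFin m) few)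
      where
        length-allFin : ∀ k → length (allFin k) ≡ k
        length-allFin k = length-tabulate id

module Extraction {m n : ℕ} (r : ℕ) (A : Mat m n) (A<r : IsRMatrix r A) (0<r : 0 < r) where
  open Staircases r A

  record HomogeneousStaircase (L : ℕ) : Set where
    field
      row : ℕ → Fin m
      col : ℕ → Fin n
      below diag above : ℕ
      on-below : ∀ a b → b < a → a < L → A (row a) (col b) ≡ below
      on-diag : ∀ a → a < L → A (row a) (col a) ≡ diag
      on-above : ∀ a b → a < b → b < L → A (row a) (col b) ≡ above
      above≢diag : above ≢ diag
      no-ones : ∀ a b → a < L → b < L → A (row a) (col b) ≢ 1

  -- A staircase of depth ramseyBound r L contains a homogeneous one of size L:
  -- apply Ramsey to the colouring of pairs by their entry below the diagonal and to
  -- the colourings of indices by their above and diagonal values.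
  homogenise : ∀ {S} L → 0 < L → Staircase S (ramseyBound r L) → HomogeneousStaircase L
  homogenise L 0<L st = record
    { row = row ∘ pos ; col = col ∘ pos
    ; below = u ; diag = w ; above = v
    ; on-below = λ a b b<a a<L → U-constant b a b<a a<L
    ; on-diag = λ a a<L → trans (on-diag (pos a) (pos-bounded a a<L)) (W-constant a a<L)
    ; on-above = λ a b a<b b<L →
        trans (on-above (pos a) (pos b) (pos-increasing a b a<b b<L) (pos-bounded b b<L))
              (V-constant a (<-trans a<b b<L))
    ; above≢diag = λ v≡w → above≢diag (pos 0) (pos-bounded 0 0<L)
                             (trans (V-constant 0 0<L) (trans v≡w (sym (W-constant 0 0<L))))
    ; no-ones = λ a b a<L b<L → no-ones (pos a) (pos b) (pos-bounded a a<L) (pos-bounded b b<L)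
    }
    where
      open Staircase st
      open Ramsey r 0<r (λ a b → A (row b) (col a)) (λ a b → A<r (row b) (col a))
      open Homogeneous (ramsey L above diag above<r diag<r)

  module Symbols {L} (H : HomogeneousStaircase L) (1<L : 1 < L) where
    open HomogeneousStaircase H

    0<L : 0 < L
    0<L = <-trans z<s 1<L

    below≢1 : below ≢ 1
    below≢1 = no-ones 1 0 1<L 0<L ∘ trans (on-below 1 0 z<s 1<L)

    diag≢1 : diag ≢ 1
    diag≢1 = no-ones 0 0 0<L 0<L ∘ trans (on-diag 0 0<L)

    above≢1 : above ≢ 1
    above≢1 = no-ones 0 1 0<L 1<L ∘ trans (on-above 0 1 z<s 1<L)

  -- For ℓ ≥ 2, a homogeneous staircase of size 2ℓ contains
  --   I_ℓ(diag, above)   on the first ℓ positions,        if below = above,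
  --   T_ℓ(above, diag)   on them in reverse order,         if below = diag,
  --   T_ℓ(below, above)  on even rows and odd columns,     otherwise.
  module Patterns {k : ℕ} (H : HomogeneousStaircase (2 + k + (2 + k))) where
    open HomogeneousStaircase H
    open Symbols H (s≤s (s≤s z≤n))

    ℓ L : ℕ
    ℓ = 2 + k
    L = ℓ + ℓ

    pick : (Fin ℓ → ℕ) → (Fin ℓ → ℕ) → Mat ℓ ℓ
    pick ρ κ = submatrix A (row ∘ ρ) (col ∘ κ)

    index<L : (a : Fin ℓ) → toℕ a < L
    index<L a = <-≤-trans (FinP.toℕ<n a) (m≤m+n ℓ ℓ)

    diagonal : below ≡ above → IsConfig ℓ diag above (pick toℕ toℕ)
    diagonal below≡above = inj₁ (imat-intro (pick toℕ toℕ) onDiag offDiag)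
      where
        onDiag : ∀ a b → toℕ a ≡ toℕ b → pick toℕ toℕ a b ≡ diag
        onDiag a b a≡b = subst (λ j → A (row (toℕ a)) (col j) ≡ diag) a≡b (on-diag (toℕ a) (index<L a))
        offDiag : ∀ a b → toℕ a ≢ toℕ b → pick toℕ toℕ a b ≡ above
        offDiag a b a≢b with <-cmp (toℕ a) (toℕ b)
        ... | tri< a<b _ _ = on-above (toℕ a) (toℕ b) a<b (index<L b)
        ... | tri≈ _ a≡b _ = ⊥-elim (a≢b a≡b)
        ... | tri> _ _ b<a = trans (on-below (toℕ a) (toℕ b) b<a (index<L a)) below≡above

    rev : Fin ℓ → ℕ
    rev a = ℓ ∸ suc (toℕ a)

    rev<L : ∀ a → rev a < L
    rev<L a = <-≤-trans (∸-monoʳ-< {o = 0} z<s (FinP.toℕ<n a)) (m≤m+n ℓ ℓ)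

    rev-reverses : ∀ a b → toℕ a < toℕ b → rev b < rev a
    rev-reverses a b a<b = ∸-monoʳ-< (s≤s a<b) (FinP.toℕ<n b)

    reversed : below ≡ diag → IsConfig ℓ above diag (pick rev rev)
    reversed below≡diag = inj₂ (tmat-intro (pick rev rev) lower upper)
      where
        lower : ∀ a b → toℕ b < toℕ a → pick rev rev a b ≡ above
        lower a b b<a = on-above (rev a) (rev b) (rev-reverses b a b<a) (rev<L b)
        upper : ∀ a b → toℕ b ≮ toℕ a → pick rev rev a b ≡ diag
        upper a b b≮a with m≤n⇒m<n∨m≡n (≮⇒≥ b≮a)
        ... | inj₁ a<b = trans (on-below (rev a) (rev b) (rev-reverses a b a<b) (rev<L a)) below≡diag
        ... | inj₂ a≡b = subst (λ j → A (row (rev a)) (col (ℓ ∸ suc j)) ≡ diag) a≡b (on-diag (rev a) (rev<L a))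

    even odd : Fin ℓ → ℕ
    even a = toℕ a + toℕ a
    odd b = suc (toℕ b + toℕ b)

    odd<L : ∀ b → odd b < L
    odd<L b = subst (_≤ L) (cong suc (+-suc (toℕ b) (toℕ b))) (+-mono-≤ (FinP.toℕ<n b) (FinP.toℕ<n b))

    even<L : ∀ a → even a < L
    even<L a = <-trans (n<1+n (even a)) (odd<L a)

    alternating : IsConfig ℓ below above (pick even odd)
    alternating = inj₂ (tmat-intro (pick even odd) lower upper)
      where
        lower : ∀ a b → toℕ b < toℕ a → pick even odd a b ≡ below
        lower a b b<a = on-below (even a) (odd b)
          (subst (_≤ even a) (cong suc (+-suc (toℕ b) (toℕ b))) (+-mono-≤ b<a b<a)) (even<L a)
        upper : ∀ a b → toℕ b ≮ toℕ a → pick even odd a b ≡ above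
        upper a b b≮a = on-above (even a) (odd b) (s≤s (+-mono-≤ a≤b a≤b)) (odd<L b)
          where
            a≤b : toℕ a ≤ toℕ b
            a≤b = ≮⇒≥ b≮a

    violates : ¬ AvoidsDiff ℓ r A
    violates avoids with below ≟ above | below ≟ diag
    ... | yes below≡above | _ =
      config-violates A A<r avoids _ _ (diagonal below≡above) (above≢diag ∘ sym) diag≢1 above≢1
    ... | no _ | yes below≡diag =
      config-violates A A<r avoids _ _ (reversed below≡diag) above≢diag above≢1 diag≢1
    ... | no below≢above | no _ =
      config-violates A A<r avoids _ _ alternating below≢above below≢1 above≢1

  -- For ℓ = 1: one of the distinct symbols diag, above is at least 2, and that
  -- single entry is I_1(z,0) with z ≥ 2.
  module Single (H : HomogeneousStaircase 2) where
    open HomogeneousStaircase H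
    open Symbols H (s≤s (s≤s z≤n))

    violates : ¬ AvoidsDiff 1 r A
    violates avoids with two-or-more above≢diag above≢1 diag≢1
    ... | inj₁ 2≤above = entry-violates A A<r avoids (row 0) (col 1)
                           (subst (2 ≤_) (sym (on-above 0 1 z<s (s≤s (s≤s z≤n)))) 2≤above)
    ... | inj₂ 2≤diag = entry-violates A A<r avoids (row 0) (col 0)
                          (subst (2 ≤_) (sym (on-diag 0 z<s)) 2≤diag)

  homogeneous-violates : ∀ ℓ → 1 ≤ ℓ → HomogeneousStaircase (ℓ + ℓ) → ¬ AvoidsDiff ℓ r A
  homogeneous-violates 1 _ H = Single.violates H
  homogeneous-violates (suc (suc k)) _ H = Patterns.violates H

staircaseDepth : ℕ → ℕ → ℕ
staircaseDepth r ℓ = ramseyBound r (ℓ + ℓ)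

-- Without rows
-- or columns the bound is immediate (a simple matrix without rows has ≤ 1 column).
upper-bound : ∀ {ℓ r m n} → 1 ≤ ℓ → 0 < r → (A : Mat m n) → Admissible ℓ r A →
              n ≤ r ^ staircaseDepth r ℓ * 2 ^ m
upper-bound {n = zero} _ _ _ _ = z≤n
upper-bound {ℓ} {r} {zero} {suc zero} _ 0<r _ _ =
  ≤-trans (m^n>0 r {{>-nonZero 0<r}} (staircaseDepth r ℓ)) (≤-reflexive (sym (*-identityʳ _)))
upper-bound {m = zero} {suc (suc n)} _ _ A (_ , simple , _) with simple Fin.zero (Fin.suc Fin.zero) (λ ())
... | ()
upper-bound {ℓ} {r} {suc m} {suc n} 1≤ℓ 0<r A (A<r , simple , avoids) =
  [ id , (λ st → ⊥-elim (homogeneous-violates ℓ 1≤ℓ (homogenise (ℓ + ℓ) 0<2ℓ st) avoids)) ]′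
    (fewOrStaircase (staircaseDepth r ℓ))
  where
    open Staircases.Construction r A A<r simple 0<r Fin.zero Fin.zero
    open Extraction r A A<r 0<r
    0<2ℓ : 0 < ℓ + ℓ
    0<2ℓ = <-≤-trans 1≤ℓ (m≤m+n ℓ ℓ)

mainTheorem6 : (r ℓ : ℕ) → 2 ≤ r → 1 ≤ ℓ →
    Σ ℕ λ M → Σ ℕ λ c → Σ ℕ λ C → 1 ≤ c ×
      (∀ (m : ℕ) → M ≤ m →
        ((∀ (n : ℕ) (A : Mat m n) → Admissible ℓ r A → n ≤ C * 2 ^ m) ×
         (Σ ℕ λ n → Σ (Mat m n) λ A → Admissible ℓ r A × 2 ^ m ≤ c * n)))
mainTheorem6 r ℓ 2≤r 1≤ℓ =
  0 , 1 , r ^ staircaseDepth r ℓ , ≤-refl ,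
  λ m _ → (λ n A admissible → upper-bound 1≤ℓ 0<r A admissible) ,
          (2 ^ m , binaryCube m , binaryCube-admissible m 1≤ℓ 2≤r , ≤-reflexive (sym (*-identityˡ (2 ^ m))))
  where
    0<r : 0 < r
    0<r = ≤-trans (s≤s z≤n) 2≤r
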